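{- Let $\mathcal{G}$ be a loopless graph with vertex set $V$ and edge set $E$ in which there are exactly two edges between each pair of adjacent vertices. Let $\overline{\mathcal{G}}$ be obtained from $\mathcal{G}$ by adding a new vertex $x$ and a pair of parallel edges between $x$ and each $v \in V$; let $\overline{E}$ be its edge set and $M = M(\overline{\mathcal{G}})$ its cycle matroid. Let $\mathcal{V} = (V_1,\ldots,V_t)$ be a path-decomposition of $\mathcal{G}$. For $j \in [t]$ let $F_j$ be the set of edges of $\mathcal{G}$ having both end-points in $V_j$, let $\overline{F_j}$ be $F_j$ together with the two edges between $x$ and $v$ for every $v \in V_j$, and let $E_j = \overline{F_j} - \bigcup_{i<j} \overline{F_i}$. Let $\pi = (e_1,\ldots,e_n)$ be any ordering of $\overline{E}$ that induces the ordered partition $(E_1,\ldots,E_t)$. Then $w_M(\pi) \le w_{\mathcal{G}}(\mathcal{V}) + 1$.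
   Context: An ordering $(e_1,\ldots,e_n)$ of a set induces an ordered partition $(E_1,\ldots,E_t)$ if for each $j$, $\{e_{n_{j-1}+1},\ldots,e_{n_j}\} = E_j$, where $n_j = |\bigcup_{i\le j} E_i|$ and $n_0=0$. For a matroid $M$ with ground set $E(M)$ and rank function $r_M$, $\lambda_M(X) = r_M(X)+r_M(E(M)-X)-r_M(E(M))$ and $w_M(e_1,\ldots,e_n) = \max_i \lambda_M(\{e_1,\ldots,e_i\})$. A path-decomposition of a graph with vertex set $V$ is a sequence $(V_1,\ldots,V_t)$ of subsets of $V$ with $\bigcup_i V_i = V$, every pair of adjacent vertices contained in some $V_i$, and $V_i\cap V_k \subseteq V_j$ for $i<j<k$; its width is $w_{\mathcal{G}}(\mathcal{V}) = \max_i |V_i|-1$. -}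

module Defs where

open import Data.Nat using (ℕ; zero; suc; _+_; _∸_; _≤_; _<ᵇ_; _⊔_)
open import Data.Fin using (Fin; toℕ) renaming (_<_ to _<ᶠ_)
open import Data.Fin.Subset using (Subset; ∣_∣) renaming (_∈_ to _∈ˢ_)
open import Data.Bool using (Bool; true; false; _∧_; _∨_; not)
open import Data.Vec using (lookup)
open import Data.List using (List; []; _∷_; _++_; map; concatMap; allFin; filterᵇ; length; take; drop)
open import Data.List.Relation.Unary.All using (All)
open import Data.List.Relation.Unary.Unique.Propositional using (Unique)
open import Data.List.Membership.Propositional using () renaming (_∈_ to _∈ₗ_)
open import Data.Product using (Σ; _×_; _,_; proj₁; proj₂)
open import Data.Sum using (_⊎_; inj₁; inj₂)
open import Data.Maybe using (Maybe; just; nothing)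
open import Data.Unit using (⊤)
open import Function.Bundles using (_⇔_)
open import Relation.Nullary using (¬_)
open import Relation.Binary.PropositionalEquality using (_≡_; _≢_)

data Walk {V E : Set} (ends : E → V × V) : V → V → List E → Set where
  []   : ∀ {u} → Walk ends u u []
  step : ∀ {u w v e es} →
         (ends e ≡ (u , w) ⊎ ends e ≡ (w , u)) →
         Walk ends w v es → Walk ends u v (e ∷ es)

HasCycleIn : {V E : Set} → (E → V × V) → (E → Set) → Set
HasCycleIn {V} {E} ends F =
  Σ V λ u → Σ (List E) λ es → (es ≢ []) × Unique es × All F es × Walk ends u u es

Independent : {V E : Set} → (E → V × V) → List E → Set
Independent ends F = Unique F × ¬ HasCycleIn ends (_∈ₗ F)

IsRank : {V E : Set} → (E → V × V) → (E → Set) → ℕ → Set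
IsRank {V} {E} ends X k =
  (Σ (List E) λ F → Independent ends F × All X F × length F ≡ k) ×
  (∀ (F : List E) → Independent ends F → All X F → length F ≤ k)

Joins : {nv m : ℕ} → (Fin m → Fin nv × Fin nv) → Fin m → Fin nv → Fin nv → Set
Joins endsG e u v = endsG e ≡ (u , v) ⊎ endsG e ≡ (v , u)

Adjacent : {nv m : ℕ} → (Fin m → Fin nv × Fin nv) → Fin nv → Fin nv → Set
Adjacent {nv} {m} endsG u v = Σ (Fin m) λ e → Joins endsG e u v

Loopless : {nv m : ℕ} → (Fin m → Fin nv × Fin nv) → Set
Loopless endsG = ∀ e → proj₁ (endsG e) ≢ proj₂ (endsG e)

ExactlyTwoParallel : {nv m : ℕ} → (Fin m → Fin nv × Fin nv) → Set
ExactlyTwoParallel {nv} {m} endsG =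
  ∀ u v → Adjacent endsG u v →
  Σ (Fin m) λ e₁ → Σ (Fin m) λ e₂ →
    e₁ ≢ e₂ × Joins endsG e₁ u v × Joins endsG e₂ u v ×
    (∀ e → Joins endsG e u v → e ≡ e₁ ⊎ e ≡ e₂)

-- The graph 𝒢‾ : new vertex x = nothing, old vertices just v;
-- edges: inj₁ e (edges of 𝒢) and inj₂ (v , b), b ∈ Bool,
-- the two parallel edges between x and v.

EdgeBar : ℕ → ℕ → Set
EdgeBar nv m = Fin m ⊎ (Fin nv × Bool)

endsBar : {nv m : ℕ} → (Fin m → Fin nv × Fin nv) →
          EdgeBar nv m → Maybe (Fin nv) × Maybe (Fin nv)
endsBar endsG (inj₁ e)       = just (proj₁ (endsG e)) , just (proj₂ (endsG e))
endsBar endsG (inj₂ (v , b)) = nothing , just v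

allEdgeBar : (nv m : ℕ) → List (EdgeBar nv m)
allEdgeBar nv m =
  map inj₁ (allFin m) ++
  concatMap (λ v → inj₂ (v , false) ∷ inj₂ (v , true) ∷ []) (allFin nv)

IsPathDecomposition : {nv m : ℕ} → (Fin m → Fin nv × Fin nv) →
                      (t : ℕ) → (Fin t → Subset nv) → Set
IsPathDecomposition {nv} {m} endsG t Vs =
  (∀ (v : Fin nv) → Σ (Fin t) λ j → v ∈ˢ Vs j) ×
  (∀ u v → Adjacent endsG u v → Σ (Fin t) λ j → u ∈ˢ Vs j × v ∈ˢ Vs j) ×
  (∀ (i j k : Fin t) → i <ᶠ j → j <ᶠ k →
     ∀ v → v ∈ˢ Vs i → v ∈ˢ Vs k → v ∈ˢ Vs j)

maxOver : (t : ℕ) → (Fin t → ℕ) → ℕ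
maxOver zero    f = 0
maxOver (suc t) f = f Data.Fin.zero ⊔ maxOver t (λ i → f (Data.Fin.suc i))

-- w_𝒢(𝒱) = max_j |V_j| - 1  (truncated subtraction; only matters for t = 0)
pathWidth : {nv : ℕ} (t : ℕ) → (Fin t → Subset nv) → ℕ
pathWidth t Vs = maxOver t (λ j → ∣ Vs j ∣) ∸ 1

anyFin : (t : ℕ) → (Fin t → Bool) → Bool
anyFin zero    f = false
anyFin (suc t) f = f Data.Fin.zero ∨ anyFin t (λ i → f (Data.Fin.suc i))

inFbar : {nv m : ℕ} → (Fin m → Fin nv × Fin nv) → {t : ℕ} →
         (Fin t → Subset nv) → Fin t → EdgeBar nv m → Bool
inFbar endsG Vs j (inj₁ e)       =
  lookup (Vs j) (proj₁ (endsG e)) ∧ lookup (Vs j) (proj₂ (endsG e))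
inFbar endsG Vs j (inj₂ (v , b)) = lookup (Vs j) v

inE : {nv m : ℕ} → (Fin m → Fin nv × Fin nv) → {t : ℕ} →
      (Fin t → Subset nv) → Fin t → EdgeBar nv m → Bool
inE endsG {t} Vs j e =
  inFbar endsG Vs j e ∧
  not (anyFin t (λ i → (toℕ i <ᵇ toℕ j) ∧ inFbar endsG Vs i e))

-- n_k = |⋃_{i < k} E_i|   (0-based indices: n_{toℕ j} precedes block j,
-- n_{suc (toℕ j)} ends it)
nUpTo : {nv m : ℕ} → (Fin m → Fin nv × Fin nv) → {t : ℕ} →
        (Fin t → Subset nv) → ℕ → ℕ
nUpTo {nv} {m} endsG {t} Vs k =
  length (filterᵇ (λ e → anyFin t (λ i → (toℕ i <ᵇ k) ∧ inE endsG Vs i e))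
                  (allEdgeBar nv m))

IsOrdering : {nv m : ℕ} → List (EdgeBar nv m) → Set
IsOrdering {nv} {m} π = Unique π × (∀ (e : EdgeBar nv m) → e ∈ₗ π)

Induces : {nv m : ℕ} → (Fin m → Fin nv × Fin nv) → {t : ℕ} →
          (Fin t → Subset nv) → List (EdgeBar nv m) → Set
Induces {nv} {m} endsG {t} Vs π =
  ∀ (j : Fin t) (e : EdgeBar nv m) →
    (e ∈ₗ drop (nUpTo endsG Vs (toℕ j)) (take (nUpTo endsG Vs (suc (toℕ j))) π))
    ⇔ (inE endsG Vs j e ≡ true)

-- Write X for the first i edges of π and Y for the others. A forest of 𝒢‾ whose edges
-- touch the vertices U ⊆ V of 𝒢 lives on U ∪ {x}, so r(X) ≤ |U(X)| and r(Y) ≤ |U(Y)|,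
-- while one of the two edges xv for every v ∈ V gives a spanning tree, so r(Ē) ≥ |V|.
-- Hence λ(X) ≤ |U(X)| + |U(Y)| − |V| ≤ |U(X) ∩ U(Y)|. Let y be the first edge of Y and
-- y ∈ E_j. As π lists E_1, E_2, … in this order, a vertex touched by X and by Y lies in
-- a bag V_i with i ≤ j and in a bag V_k with k ≥ j, hence in V_j; so λ(X) ≤ |V_j|.

module Submission where

open import Defs
open import Data.Nat using (ℕ; zero; suc; _+_; _∸_; _≤_; _<_; _<ᵇ_; z≤n; s≤s)
open import Data.Nat.Properties
  using ( ≤-refl; ≤-trans; ≤-reflexive; ≤-total; ≤-pred; <-≤-trans; ≮⇒≥; m≤n⇒m<n∨m≡n
        ; m≤n⇒m≤1+n; <ᵇ⇒<; <⇒<ᵇ; m≤m⊔n; m≤n⊔m; m≤n+m∸n; m+n∸m≡n; +-comm; +-suc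
        ; +-monoʳ-≤; +-monoˡ-≤; +-mono-≤; ∸-mono; ∸-monoˡ-≤; module ≤-Reasoning)
open import Data.Bool using (Bool; true; false; _∧_; _∨_; not; T; T?)
import Data.Bool.Properties as Bool
open import Data.Fin using (Fin; toℕ) renaming (zero to fzero; suc to fsuc; _≟_ to _≟ᶠ_)
open import Data.Fin.Properties using (toℕ-injective)
open import Data.Fin.Subset using (Subset; inside; outside; ∣_∣; _∪_; _∩_; ⁅_⁆)
  renaming (_∈_ to _∈ˢ_; _⊆_ to _⊆ˢ_; ⊥ to ∅)
open import Data.Fin.Subset.Properties
  using ( x∈⁅x⁆; x∈⁅y⁆⇒x≡y; x∈p∪q⁺; x∈p∪q⁻; x∈p∩q⁻; ∉⊥; ∣p∣≤n; p⊆q⇒∣p∣≤∣q∣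
        ; ∩-zeroʳ; ∣⊥∣≡0)
open import Data.Vec using ([]; _∷_; lookup) renaming (here to here=; there to there=)
open import Data.Vec.Properties using ([]=⇒lookup; lookup⇒[]=)
open import Data.Maybe using (Maybe; just; nothing)
import Data.Maybe.Properties as Maybe
open import Data.List using (List; []; _∷_; _++_; length; filter; map; tabulate; take; drop)
open import Data.List.Properties using (length-filter; length-map; length-tabulate)
open import Data.List.Relation.Unary.All using (All; []; _∷_; universal) renaming (map to All-map)
open import Data.List.Relation.Unary.All.Properties using (¬Any⇒All¬; All¬⇒¬Any; ++⁺)
open import Data.List.Relation.Unary.Any using (here; there)
open import Data.List.Relation.Unary.AllPairs using ([]; _∷_)
open import Data.List.Relation.Unary.Unique.Propositional using (Unique)
import Data.List.Relation.Unary.Unique.Propositional.Properties as Unique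
open import Data.List.Membership.Propositional using (_∈_; _∉_)
open import Data.List.Membership.Propositional.Properties using (∈-filter⁺; ∈-map⁺; ∈-tabulate⁻)
import Data.List.Membership.DecPropositional as DecMembership
open import Data.Product using (Σ; ∃; _×_; _,_; proj₁; proj₂)
import Data.Product.Properties as Product
open import Data.Sum using (_⊎_; inj₁; inj₂)
import Data.Sum.Properties as Sum
open import Data.Unit using (⊤; tt)
open import Function using (_∘_)
open import Function.Bundles using (Equivalence)
open import Level using (0ℓ)
open import Relation.Nullary using (¬_; yes; no; contradiction)
open import Relation.Unary using (Pred; Decidable)
open import Relation.Binary.Definitions using (DecidableEquality)
open import Relation.Binary.PropositionalEquality using (_≡_; _≢_; refl; sym; trans; cong; cong₂; subst)

module _ {A : Set} {P Q : Pred A 0ℓ} (P? : Decidable P) (Q? : Decidable Q)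
         (P⇒Q : ∀ {x} → P x → Q x) where

  length-filter-mono : ∀ xs → length (filter P? xs) ≤ length (filter Q? xs)
  length-filter-mono [] = z≤n
  length-filter-mono (x ∷ xs) with P? x | Q? x
  ... | yes _  | yes _  = s≤s (length-filter-mono xs)
  ... | yes px | no ¬qx = contradiction (P⇒Q px) ¬qx
  ... | no _   | yes _  = m≤n⇒m≤1+n (length-filter-mono xs)
  ... | no _   | no _   = length-filter-mono xs

  length-filter-< : ∀ {x xs} → x ∈ xs → Q x → ¬ P x →
                    length (filter P? xs) < length (filter Q? xs)
  length-filter-< {xs = x ∷ xs} (here refl) qx ¬px with P? x | Q? x
  ... | yes px | _      = contradiction px ¬px
  ... | no _   | yes _  = s≤s (length-filter-mono xs)
  ... | no _   | no ¬qx = contradiction qx ¬qx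
  length-filter-< {xs = y ∷ xs} (there x∈xs) qx ¬px with P? y | Q? y
  ... | yes _  | yes _  = s≤s (length-filter-< x∈xs qx ¬px)
  ... | yes py | no ¬qy = contradiction (P⇒Q py) ¬qy
  ... | no _   | yes _  = m≤n⇒m≤1+n (length-filter-< x∈xs qx ¬px)
  ... | no _   | no _   = length-filter-< x∈xs qx ¬px

∈⇒0<length : {A : Set} {x : A} {xs : List A} → x ∈ xs → 0 < length xs
∈⇒0<length (here _)  = s≤s z≤n
∈⇒0<length (there _) = s≤s z≤n

module _ {A : Set} where

  ∈-take⁻ : ∀ n {xs : List A} {x} → x ∈ take n xs → x ∈ xs
  ∈-take⁻ (suc n) {_ ∷ _} (here refl) = here refl
  ∈-take⁻ (suc n) {_ ∷ _} (there x∈) = there (∈-take⁻ n x∈)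

  ∈-drop⁻ : ∀ n {xs : List A} {x} → x ∈ drop n xs → x ∈ xs
  ∈-drop⁻ zero    x∈ = x∈
  ∈-drop⁻ (suc n) {_ ∷ _} x∈ = there (∈-drop⁻ n x∈)

  ∈-take-mono : ∀ {m n} {xs : List A} {x} → m ≤ n → x ∈ take m xs → x ∈ take n xs
  ∈-take-mono {xs = _ ∷ _} (s≤s _)   (here refl) = here refl
  ∈-take-mono {xs = _ ∷ _} (s≤s m≤n) (there x∈)  = there (∈-take-mono m≤n x∈)

  ∈-drop-mono : ∀ {m n} {xs : List A} {x} → m ≤ n → x ∈ drop n xs → x ∈ drop m xs
  ∈-drop-mono {n = n} z≤n x∈ = ∈-drop⁻ n x∈
  ∈-drop-mono {xs = _ ∷ _} (s≤s m≤n) x∈ = ∈-drop-mono m≤n x∈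

  ∈-drop-take⁻ : ∀ m n {xs : List A} {x} → x ∈ drop m (take n xs) → x ∈ drop m xs
  ∈-drop-take⁻ zero    n x∈ = ∈-take⁻ n x∈
  ∈-drop-take⁻ (suc m) (suc n) {_ ∷ _} x∈ = ∈-drop-take⁻ m n x∈

  ∉-take⇒∈-drop : ∀ n {xs : List A} {x} → x ∈ xs → x ∉ take n xs → x ∈ drop n xs
  ∉-take⇒∈-drop zero    x∈          _ = x∈
  ∉-take⇒∈-drop (suc n) (here refl) x∉ = contradiction (here refl) x∉
  ∉-take⇒∈-drop (suc n) (there x∈)  x∉ = ∉-take⇒∈-drop n x∈ (x∉ ∘ there)

  ∈-take⇒∉-drop : ∀ n {xs : List A} {x} → Unique xs → x ∈ take n xs → x ∉ drop n xs
  ∈-take⇒∉-drop (suc n) {_ ∷ _} (x∉ ∷ _) (here refl) x∈drop = All¬⇒¬Any x∉ (∈-drop⁻ n x∈drop)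
  ∈-take⇒∉-drop (suc n) {_ ∷ _} (_ ∷ u)  (there x∈)  x∈drop = ∈-take⇒∉-drop n u x∈ x∈drop

  drop-∷ : ∀ i {xs : List A} {y ys} → drop i xs ≡ y ∷ ys →
           y ∈ take (suc i) xs × drop (suc i) xs ≡ ys
  drop-∷ zero    {_ ∷ _} refl = here refl , refl
  drop-∷ (suc i) {_ ∷ _} eq with drop-∷ i eq
  ... | y∈ , eq′ = there y∈ , eq′

elements : {n : ℕ} → Subset n → List (Fin n)
elements []            = []
elements (inside ∷ p)  = fzero ∷ map fsuc (elements p)
elements (outside ∷ p) = map fsuc (elements p)

∈-elements : {n : ℕ} {p : Subset n} {x : Fin n} → x ∈ˢ p → x ∈ elements p
∈-elements {p = inside ∷ p}  here= = here refl
∈-elements {p = inside ∷ p}  (there= x∈p) = there (∈-map⁺ fsuc (∈-elements x∈p))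
∈-elements {p = outside ∷ p} (there= x∈p) = ∈-map⁺ fsuc (∈-elements x∈p)

length-elements : {n : ℕ} (p : Subset n) → length (elements p) ≡ ∣ p ∣
length-elements []            = refl
length-elements (inside ∷ p)  = cong suc (trans (length-map fsuc (elements p)) (length-elements p))
length-elements (outside ∷ p) = trans (length-map fsuc (elements p)) (length-elements p)

∣p∣+∣q∣≡∣p∪q∣+∣p∩q∣ : {n : ℕ} (p q : Subset n) → ∣ p ∣ + ∣ q ∣ ≡ ∣ p ∪ q ∣ + ∣ p ∩ q ∣
∣p∣+∣q∣≡∣p∪q∣+∣p∩q∣ []            []            = refl
∣p∣+∣q∣≡∣p∪q∣+∣p∩q∣ (inside ∷ p)  (inside ∷ q)  =
  cong suc (trans (+-suc ∣ p ∣ ∣ q ∣)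
                  (trans (cong suc (∣p∣+∣q∣≡∣p∪q∣+∣p∩q∣ p q)) (sym (+-suc ∣ p ∪ q ∣ ∣ p ∩ q ∣))))
∣p∣+∣q∣≡∣p∪q∣+∣p∩q∣ (inside ∷ p)  (outside ∷ q) = cong suc (∣p∣+∣q∣≡∣p∪q∣+∣p∩q∣ p q)
∣p∣+∣q∣≡∣p∪q∣+∣p∩q∣ (outside ∷ p) (inside ∷ q)  =
  trans (+-suc ∣ p ∣ ∣ q ∣) (cong suc (∣p∣+∣q∣≡∣p∪q∣+∣p∩q∣ p q))
∣p∣+∣q∣≡∣p∪q∣+∣p∩q∣ (outside ∷ p) (outside ∷ q) = ∣p∣+∣q∣≡∣p∪q∣+∣p∩q∣ p q

∣p∣+∣q∣∸n≤∣p∩q∣ : {n : ℕ} (p q : Subset n) → ∣ p ∣ + ∣ q ∣ ∸ n ≤ ∣ p ∩ q ∣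
∣p∣+∣q∣∸n≤∣p∩q∣ {n} p q = begin
  ∣ p ∣ + ∣ q ∣ ∸ n              ≡⟨ cong (_∸ n) (∣p∣+∣q∣≡∣p∪q∣+∣p∩q∣ p q) ⟩
  ∣ p ∪ q ∣ + ∣ p ∩ q ∣ ∸ n      ≤⟨ ∸-monoˡ-≤ n (+-monoˡ-≤ ∣ p ∩ q ∣ (∣p∣≤n (p ∪ q))) ⟩
  n + ∣ p ∩ q ∣ ∸ n              ≡⟨ m+n∸m≡n n ∣ p ∩ q ∣ ⟩
  ∣ p ∩ q ∣                      ∎
  where open ≤-Reasoning

∧-true⁻ : ∀ x y → x ∧ y ≡ true → x ≡ true × y ≡ true
∧-true⁻ true true _ = refl , refl

maxOver-≥ : ∀ t (f : Fin t → ℕ) j → f j ≤ maxOver t f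
maxOver-≥ (suc t) f fzero    = m≤m⊔n (f fzero) _
maxOver-≥ (suc t) f (fsuc j) = ≤-trans (maxOver-≥ t (λ i → f (fsuc i)) j) (m≤n⊔m (f fzero) _)

anyFin-true⁺ : ∀ t (g : Fin t → Bool) j → g j ≡ true → anyFin t g ≡ true
anyFin-true⁺ (suc t) g fzero    gj = cong (_∨ anyFin t (λ i → g (fsuc i))) gj
anyFin-true⁺ (suc t) g (fsuc j) gj =
  trans (cong (g fzero ∨_) (anyFin-true⁺ t (λ i → g (fsuc i)) j gj)) (Bool.∨-zeroʳ (g fzero))

anyFin-true⁻ : ∀ t (g : Fin t → Bool) → anyFin t g ≡ true → ∃ λ j → g j ≡ true
anyFin-true⁻ (suc t) g any with g fzero in g0
... | true  = fzero , g0
... | false with anyFin-true⁻ t (λ i → g (fsuc i)) any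
...   | j , gj = fsuc j , gj

anyFin-false⁺ : ∀ t (g : Fin t → Bool) → (∀ i → g i ≡ false) → anyFin t g ≡ false
anyFin-false⁺ zero    g none = refl
anyFin-false⁺ (suc t) g none =
  cong₂ _∨_ (none fzero) (anyFin-false⁺ t (λ i → g (fsuc i)) (λ i → none (fsuc i)))

least-true : ∀ t (g : Fin t → Bool) j → g j ≡ true →
             ∃ λ j′ → g j′ ≡ true × (∀ i → toℕ i < toℕ j′ → g i ≡ false)
least-true (suc t) g j gj with g fzero in g0
... | true = fzero , g0 , λ _ ()
least-true (suc t) g fzero    gj | false = contradiction (trans (sym g0) gj) (λ ())
least-true (suc t) g (fsuc j) gj | false with least-true t (λ i → g (fsuc i)) j gj
... | j′ , gj′ , before = fsuc j′ , gj′ , earlier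
  where
  earlier : ∀ i → toℕ i < toℕ (fsuc j′) → g i ≡ false
  earlier fzero    _         = g0
  earlier (fsuc i) (s≤s i<j) = before i i<j

-- Walks, trails and forests

walk-++ : {V E : Set} {ends : E → V × V} {a b c : V} {xs ys : List E} →
          Walk ends a b xs → Walk ends b c ys → Walk ends a c (xs ++ ys)
walk-++ []         w₂ = w₂
walk-++ (step l w₁) w₂ = step l (walk-++ w₁ w₂)

module Forest {V E : Set} (_≟ᵥ_ : DecidableEquality V) (_≟ₑ_ : DecidableEquality E)
              (ends : E → V × V) where

  open DecMembership _≟ₑ_ using (_∈?_)

  Links : E → V → V → Set
  Links e u w = ends e ≡ (u , w) ⊎ ends e ≡ (w , u)

  links-far-end : ∀ {e u w y z} → Links e u w → Links e y z → z ≡ u ⊎ z ≡ w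
  links-far-end (inj₁ p) (inj₁ q) = inj₂ (cong proj₂ (trans (sym q) p))
  links-far-end (inj₁ p) (inj₂ q) = inj₁ (cong proj₁ (trans (sym q) p))
  links-far-end (inj₂ p) (inj₁ q) = inj₁ (cong proj₂ (trans (sym q) p))
  links-far-end (inj₂ p) (inj₂ q) = inj₂ (cong proj₁ (trans (sym q) p))

  record Trail (P : E → Set) (a b : V) : Set where
    constructor trail
    field
      {edges} : List E
      distinct : Unique edges
      within   : All P edges
      walk     : Walk ends a b edges

  record Crossing (P : E → Set) (e : E) (b : V) : Set where
    constructor crossing
    field
      {near far} : V
      {rest}     : List E
      links      : Links e near far
      distinct   : Unique (e ∷ rest)
      within     : All P rest
      walk       : Walk ends far b rest

  crossing-of : ∀ {P e w b es} → Walk ends w b es → Unique es → All P es → e ∈ es →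
                Crossing P e b
  crossing-of (step l w) u         (_ ∷ ps) (here refl) = crossing l u ps w
  crossing-of (step _ w) (_ ∷ u)   (_ ∷ ps) (there e∈) = crossing-of w u ps e∈

  -- If e already occurs in the trail of the rest, continue from where that trail crosses e.
  walk⇒trail : ∀ {P a b es} → Walk ends a b es → All P es → Trail P a b
  walk⇒trail []                 []         = trail [] [] []
  walk⇒trail (step {e = e} l w) (pe ∷ ps) with walk⇒trail w ps
  ... | trail {es} u qs w′ with e ∈? es
  ...   | no e∉ = trail (¬Any⇒All¬ es e∉ ∷ u) (pe ∷ qs) (step l w′)
  ...   | yes e∈ with crossing-of w′ u qs e∈
  ...     | crossing l′ (n ∷ u′) qs′ w″ with links-far-end l l′
  ...       | inj₁ refl = trail u′ qs′ w″
  ...       | inj₂ refl = trail (n ∷ u′) (pe ∷ qs′) (step l w″)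

  Connected : List E → V → V → Set
  Connected L a b = Σ (List E) λ es → All (_∈ L) es × Walk ends a b es

  connected-∷ : ∀ {e L a b} → Connected L a b → Connected (e ∷ L) a b
  connected-∷ (es , in-L , w) = es , All-map there in-L , w

  connected-via : ∀ {e L a u w b} →
                  Connected L a u → Links e u w → Connected L w b → Connected (e ∷ L) a b
  connected-via (es₁ , in₁ , w₁) l (es₂ , in₂ , w₂) =
    _ , ++⁺ (All-map there in₁) (here refl ∷ All-map there in₂) , walk-++ w₁ (step l w₂)

  closing-cycle : ∀ {e L u w} → e ∉ L → Links e u w → Connected L w u →
                  HasCycleIn ends (_∈ e ∷ L)
  closing-cycle {e} {L} e∉L l (_ , in-L , w) with walk⇒trail w in-L
  ... | trail u in-L′ w′ =
    _ , _ , (λ ()) , All-map differs in-L′ ∷ u , here refl ∷ All-map there in-L′ , step l w′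
    where
    differs : ∀ {x} → x ∈ L → e ≢ x
    differs x∈L refl = e∉L x∈L

  acyclic-∷⁻ : ∀ {e L} → ¬ HasCycleIn ends (_∈ e ∷ L) → ¬ HasCycleIn ends (_∈ L)
  acyclic-∷⁻ acyclic (u , es , ne , un , in-L , w) = acyclic (u , es , ne , un , All-map there in-L , w)

  module _ (vs : List V) where

    EndsIn : E → Set
    EndsIn e = proj₁ (ends e) ∈ vs × proj₂ (ends e) ∈ vs

    -- f sends each vertex to a representative of its connected component in L
    record Labelling (L : List E) (f : V → V) : Set where
      field
        idempotent : ∀ x → f (f x) ≡ f x
        closed     : ∀ {x} → x ∈ vs → f x ∈ vs
        connects   : ∀ {a b} → f a ≡ f b → Connected L a b

    representatives : (V → V) → List V
    representatives f = filter (λ x → f x ≟ᵥ x) vs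

    -- An edge e added to an acyclic L joins two components p ≠ q; relabelling q as p
    -- keeps the invariant and loses the representative q.
    module Merge {L f e} (lab : Labelling L f) (e∉L : e ∉ L) (ends∈ : EndsIn e)
                 (acyclic : ¬ HasCycleIn ends (_∈ e ∷ L)) where

      open Labelling lab

      p q : V
      p = f (proj₁ (ends e))
      q = f (proj₂ (ends e))

      p≢q : p ≢ q
      p≢q p≡q = acyclic (closing-cycle e∉L (inj₁ refl) (connects (sym p≡q)))

      relabel : V → V
      relabel x with f x ≟ᵥ q
      ... | yes _ = p
      ... | no _  = f x

      relabel-cases : ∀ x → (f x ≡ q × relabel x ≡ p) ⊎ (f x ≢ q × relabel x ≡ f x)
      relabel-cases x with f x ≟ᵥ q
      ... | yes fx≡q = inj₁ (fx≡q , refl)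
      ... | no fx≢q  = inj₂ (fx≢q , refl)

      relabel-fixed : ∀ y → f y ≡ y → y ≢ q → relabel y ≡ y
      relabel-fixed y fy≡y y≢q with relabel-cases y
      ... | inj₁ (fy≡q , _) = contradiction (trans (sym fy≡y) fy≡q) y≢q
      ... | inj₂ (_ , r≡fy) = trans r≡fy fy≡y

      relabel-idempotent : ∀ x → relabel (relabel x) ≡ relabel x
      relabel-idempotent x with relabel-cases x
      ... | inj₁ (_ , r≡p) rewrite r≡p = relabel-fixed p (idempotent _) p≢q
      ... | inj₂ (fx≢q , r≡fx) rewrite r≡fx =
        relabel-fixed (f x) (idempotent x) fx≢q

      relabel-closed : ∀ {x} → x ∈ vs → relabel x ∈ vs
      relabel-closed {x} x∈ with relabel-cases x
      ... | inj₁ (_ , r≡p)  rewrite r≡p  = closed (proj₁ ends∈)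
      ... | inj₂ (_ , r≡fx) rewrite r≡fx = closed x∈

      relabel-connects : ∀ {a b} → relabel a ≡ relabel b → Connected (e ∷ L) a b
      relabel-connects {a} {b} ra≡rb with relabel-cases a | relabel-cases b
      ... | inj₁ (fa≡q , _) | inj₁ (fb≡q , _) = connected-∷ (connects (trans fa≡q (sym fb≡q)))
      ... | inj₂ (_ , ra) | inj₂ (_ , rb) =
        connected-∷ (connects (trans (sym ra) (trans ra≡rb rb)))
      ... | inj₂ (_ , ra) | inj₁ (fb≡q , rb) =
        connected-via (connects (trans (sym ra) (trans ra≡rb rb))) (inj₁ refl)
                      (connects (sym fb≡q))
      ... | inj₁ (fa≡q , ra) | inj₂ (_ , rb) =
        connected-via (connects fa≡q) (inj₂ refl)
                      (connects (trans (sym ra) (trans ra≡rb rb)))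

      labelling : Labelling (e ∷ L) relabel
      labelling = record
        { idempotent = relabel-idempotent
        ; closed     = relabel-closed
        ; connects   = relabel-connects
        }

      fewer-representatives :
        length (representatives relabel) < length (representatives f)
      fewer-representatives =
        length-filter-< (λ x → relabel x ≟ᵥ x) (λ x → f x ≟ᵥ x) still-fixed
          (closed (proj₂ ends∈)) (idempotent _) q-moves
        where
        still-fixed : ∀ {x} → relabel x ≡ x → f x ≡ x
        still-fixed {x} rx≡x with relabel-cases x
        ... | inj₁ (fx≡q , r≡p) =
          contradiction (trans (sym (idempotent _)) (trans (cong f (trans (sym r≡p) rx≡x)) fx≡q)) p≢q
        ... | inj₂ (_ , r≡fx) = trans (sym r≡fx) rx≡x
        q-moves : relabel q ≢ q
        q-moves rq≡q with relabel-cases q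
        ... | inj₁ (_ , r≡p) = p≢q (trans (sym r≡p) rq≡q)
        ... | inj₂ (fq≢q , _) = fq≢q (idempotent _)

    forest-labelling : ∀ F → Independent ends F → All EndsIn F →
      Σ (V → V) λ f → Labelling F f × length F + length (representatives f) ≤ length vs
    forest-labelling [] _ _ =
      (λ x → x) , record { idempotent = λ _ → refl ; closed = λ x∈ → x∈
                         ; connects = λ { refl → [] , [] , [] } }
                , length-filter _ vs
    forest-labelling (e ∷ L) (e∉ ∷ uL , acyclic) (ends∈ ∷ ends∈s)
      with forest-labelling L (uL , acyclic-∷⁻ acyclic) ends∈s
    ... | f , lab , bound = relabel , labelling ,
          ≤-trans (≤-reflexive (sym (+-suc (length L) _)))
                  (≤-trans (+-monoʳ-≤ (length L) fewer-representatives) bound)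
      where open Merge lab (All¬⇒¬Any e∉) ends∈ acyclic

    independent-length< : ∀ {F x} → Independent ends F → All EndsIn F → x ∈ vs → length F < length vs
    independent-length< {F} {x} ind ends∈s x∈ with forest-labelling F ind ends∈s
    ... | f , lab , bound =
      ≤-trans (≤-reflexive (+-comm 1 (length F)))
              (≤-trans (+-monoʳ-≤ (length F) (∈⇒0<length fx-represents)) bound)
      where
      open Labelling lab
      fx-represents : f x ∈ representatives f
      fx-represents = ∈-filter⁺ (λ y → f y ≟ᵥ y) (closed x∈) (idempotent x)

-- The graph 𝒢‾

decEdgeBar : {nv m : ℕ} → DecidableEquality (EdgeBar nv m)
decEdgeBar = Sum.≡-dec _≟ᶠ_ (Product.≡-dec _≟ᶠ_ Bool._≟_)

module _ {nv m : ℕ} (endsG : Fin m → Fin nv × Fin nv) where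

  open Forest (Maybe.≡-dec _≟ᶠ_) decEdgeBar (endsBar endsG)

  -- x is left out of these vertex sets and added back in spanned.
  incident : EdgeBar nv m → Subset nv
  incident (inj₁ e)       = ⁅ proj₁ (endsG e) ⁆ ∪ ⁅ proj₂ (endsG e) ⁆
  incident (inj₂ (v , _)) = ⁅ v ⁆

  touched : List (EdgeBar nv m) → Subset nv
  touched []      = ∅
  touched (e ∷ L) = incident e ∪ touched L

  touched⁺ : ∀ {L e v} → e ∈ L → v ∈ˢ incident e → v ∈ˢ touched L
  touched⁺ (here refl) v∈e = x∈p∪q⁺ (inj₁ v∈e)
  touched⁺ (there e∈L) v∈e = x∈p∪q⁺ (inj₂ (touched⁺ e∈L v∈e))

  touched⁻ : ∀ L {v} → v ∈ˢ touched L → ∃ λ e → e ∈ L × v ∈ˢ incident e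
  touched⁻ []      v∈ = contradiction v∈ ∉⊥
  touched⁻ (e ∷ L) v∈ with x∈p∪q⁻ (incident e) (touched L) v∈
  ... | inj₁ v∈e = e , here refl , v∈e
  ... | inj₂ v∈L with touched⁻ L v∈L
  ...   | e′ , e′∈L , v∈e′ = e′ , there e′∈L , v∈e′

  spanned : List (EdgeBar nv m) → List (Maybe (Fin nv))
  spanned L = nothing ∷ map just (elements (touched L))

  ends-spanned : ∀ {L e} → e ∈ L → EndsIn (spanned L) e
  ends-spanned {e = inj₁ e} e∈L =
    there (∈-map⁺ just (∈-elements (touched⁺ e∈L (x∈p∪q⁺ (inj₁ (x∈⁅x⁆ _)))))) ,
    there (∈-map⁺ just (∈-elements (touched⁺ e∈L (x∈p∪q⁺ (inj₂ (x∈⁅x⁆ _))))))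
  ends-spanned {e = inj₂ (v , _)} e∈L =
    here refl , there (∈-map⁺ just (∈-elements (touched⁺ e∈L (x∈⁅x⁆ v))))

  length-spanned : ∀ L → length (spanned L) ≡ suc ∣ touched L ∣
  length-spanned L =
    cong suc (trans (length-map just (elements (touched L))) (length-elements (touched L)))

  rank≤∣touched∣ : ∀ {X r} L → IsRank (endsBar endsG) X r → (∀ {e} → X e → e ∈ L) →
                   r ≤ ∣ touched L ∣
  rank≤∣touched∣ L ((F , F-independent , F⊆X , refl) , _) X⊆L =
    ≤-pred (≤-trans (independent-length< (spanned L) F-independent
                                         (All-map (ends-spanned ∘ X⊆L) F⊆X) (here refl))
                    (≤-reflexive (length-spanned L)))

  -- One of the two parallel edges xv for each v ∈ V: a spanning tree of 𝒢‾.
  spoke : Fin nv → EdgeBar nv m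
  spoke v = inj₂ (v , false)

  star : List (EdgeBar nv m)
  star = tabulate spoke

  IsSpoke : EdgeBar nv m → Set
  IsSpoke e = ∃ λ v → e ≡ spoke v

  spoke-entered : ∀ {a v es} → Walk (endsBar endsG) a (just v) es → All IsSpoke es →
                  a ≢ just v → spoke v ∈ es
  spoke-entered []                        _                  a≢v = contradiction refl a≢v
  spoke-entered {v = v} (step {w = w} l rest) ((_ , refl) ∷ spokes) a≢v
    with Maybe.≡-dec _≟ᶠ_ w (just v)
  ... | no w≢v = there (spoke-entered rest spokes w≢v)
  ... | yes refl with l
  ...   | inj₁ refl = here refl

  star-acyclic : ¬ HasCycleIn (endsBar endsG) (_∈ star)
  star-acyclic (_ , [] , nonempty , _) = nonempty refl
  star-acyclic (_ , e ∷ rest , _ , (e∉rest ∷ _) , (e∈star ∷ in-star) , step l w)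
    with ∈-tabulate⁻ e∈star
  ... | v , refl with l
  ...   | inj₂ refl =
    All¬⇒¬Any e∉rest (spoke-entered w (All-map ∈-tabulate⁻ in-star) (λ ()))
  ...   | inj₁ refl with w | in-star | e∉rest
  ...     | step l′ _ | e′∈star ∷ _ | e≢e′ ∷ _ with ∈-tabulate⁻ e′∈star
  ...       | v′ , refl with l′
  ...         | inj₂ refl = e≢e′ refl

  nv≤full-rank : ∀ {c} → IsRank (endsBar endsG) (λ _ → ⊤) c → nv ≤ c
  nv≤full-rank (_ , maximal) =
    ≤-trans (≤-reflexive (sym (length-tabulate spoke)))
            (maximal star (Unique.tabulate⁺ (λ { refl → refl }) , star-acyclic)
                     (universal (λ _ → tt) star))

-- Path-decompositions and the ordering π

module _ {nv m : ℕ} (endsG : Fin m → Fin nv × Fin nv) {t : ℕ} (Vs : Fin t → Subset nv)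
         (pd : IsPathDecomposition endsG t Vs) where

  private
    inFbar′ = inFbar endsG Vs
    inE′    = inE endsG Vs
    nUpTo′  = nUpTo endsG Vs

  ∈-bag : ∀ {j v} → lookup (Vs j) v ≡ true → v ∈ˢ Vs j
  ∈-bag {j} {v} = lookup⇒[]= v (Vs j)

  incident⊆bag : ∀ j e → inFbar′ j e ≡ true → incident endsG e ⊆ˢ Vs j
  incident⊆bag j (inj₁ e) in-j v∈e
    with ∧-true⁻ (lookup (Vs j) (proj₁ (endsG e))) (lookup (Vs j) (proj₂ (endsG e))) in-j
       | x∈p∪q⁻ _ _ v∈e
  ... | u∈ , _ | inj₁ v∈u rewrite x∈⁅y⁆⇒x≡y _ v∈u = ∈-bag u∈
  ... | _ , w∈ | inj₂ v∈w rewrite x∈⁅y⁆⇒x≡y _ v∈w = ∈-bag w∈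
  incident⊆bag j (inj₂ (w , _)) in-j v∈e rewrite x∈⁅y⁆⇒x≡y _ v∈e = ∈-bag in-j

  some-bag : ∀ e → ∃ λ j → inFbar′ j e ≡ true
  some-bag (inj₁ e) with proj₁ (proj₂ pd) _ _ (e , inj₁ refl)
  ... | j , u∈ , w∈ = j , cong₂ _∧_ ([]=⇒lookup u∈) ([]=⇒lookup w∈)
  some-bag (inj₂ (v , _)) with proj₁ pd v
  ... | j , v∈ = j , []=⇒lookup v∈

  -- the edges of E_j are those whose first bag is V_j
  first-block : ∀ e → ∃ λ j → inE′ j e ≡ true
  first-block e with some-bag e
  ... | j , in-j with least-true t (λ i → inFbar′ i e) j in-j
  ...   | j′ , in-j′ , before =
    j′ , cong₂ _∧_ in-j′ (cong not (anyFin-false⁺ t _ not-earlier))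
    where
    not-earlier : ∀ i → ((toℕ i <ᵇ toℕ j′) ∧ inFbar′ i e) ≡ false
    not-earlier i with toℕ i <ᵇ toℕ j′ in lt
    ... | false = refl
    ... | true  = before i (<ᵇ⇒< (toℕ i) (toℕ j′) (Equivalence.from Bool.T-≡ lt))

  block : EdgeBar nv m → Fin t
  block e = proj₁ (first-block e)

  ∈-block : ∀ e → inE′ (block e) e ≡ true
  ∈-block e = proj₂ (first-block e)

  incident⊆block : ∀ e → incident endsG e ⊆ˢ Vs (block e)
  incident⊆block e =
    incident⊆bag (block e) e (proj₁ (∧-true⁻ (inFbar′ (block e) e) _ (∈-block e)))

  bag-interval : ∀ {j₁ j j₂ v} → toℕ j₁ ≤ toℕ j → toℕ j ≤ toℕ j₂ →
                 v ∈ˢ Vs j₁ → v ∈ˢ Vs j₂ → v ∈ˢ Vs j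
  bag-interval j₁≤j j≤j₂ v∈₁ v∈₂ with m≤n⇒m<n∨m≡n j₁≤j | m≤n⇒m<n∨m≡n j≤j₂
  ... | inj₂ j₁≡j | _         rewrite toℕ-injective j₁≡j = v∈₁
  ... | inj₁ _    | inj₂ j≡j₂ rewrite toℕ-injective j≡j₂ = v∈₂
  ... | inj₁ j₁<j | inj₁ j<j₂ = proj₂ (proj₂ pd) _ _ _ j₁<j j<j₂ _ v∈₁ v∈₂

  nUpTo-mono : ∀ {k k′} → k ≤ k′ → nUpTo′ k ≤ nUpTo′ k′
  nUpTo-mono {k} {k′} k≤k′ =
    length-filter-mono (λ e → T? (anyFin t (earlier k e))) (λ e → T? (anyFin t (earlier k′ e)))
                       (λ {e} → later {e}) (allEdgeBar nv m)
    where
    earlier : ℕ → EdgeBar nv m → Fin t → Bool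
    earlier k e i = (toℕ i <ᵇ k) ∧ inE′ i e
    later : ∀ {e} → T (anyFin t (earlier k e)) → T (anyFin t (earlier k′ e))
    later {e} in-k with anyFin-true⁻ t (earlier k e) (Equivalence.to Bool.T-≡ in-k)
    ... | i , i-in with ∧-true⁻ (toℕ i <ᵇ k) (inE′ i e) i-in
    ...   | i<k , in-i =
      Equivalence.from Bool.T-≡ (anyFin-true⁺ t (earlier k′ e) i (cong₂ _∧_ i<k′ in-i))
      where
      i<k′ : (toℕ i <ᵇ k′) ≡ true
      i<k′ = Equivalence.to Bool.T-≡
               (<⇒<ᵇ (<-≤-trans (<ᵇ⇒< (toℕ i) k (Equivalence.from Bool.T-≡ i<k)) k≤k′))

  ∣bag∣≤width+1 : ∀ j → ∣ Vs j ∣ ≤ pathWidth t Vs + 1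
  ∣bag∣≤width+1 j =
    ≤-trans (maxOver-≥ t (λ i → ∣ Vs i ∣) j)
            (≤-trans (m≤n+m∸n _ 1) (≤-reflexive (+-comm 1 (pathWidth t Vs))))

  module _ {π : List (EdgeBar nv m)} (distinct : Unique π) (induces : Induces endsG Vs π) where

    private
      ∈-segment : ∀ e →
                  e ∈ drop (nUpTo′ (toℕ (block e))) (take (nUpTo′ (suc (toℕ (block e)))) π)
      ∈-segment e = Equivalence.from (induces (block e) e) (∈-block e)

    block-∈-drop : ∀ e → e ∈ drop (nUpTo′ (toℕ (block e))) π
    block-∈-drop e =
      ∈-drop-take⁻ (nUpTo′ (toℕ (block e))) (nUpTo′ (suc (toℕ (block e)))) (∈-segment e)

    block-∈-take : ∀ e → e ∈ take (nUpTo′ (suc (toℕ (block e)))) π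
    block-∈-take e = ∈-drop⁻ (nUpTo′ (toℕ (block e))) (∈-segment e)

    block-order : ∀ k {e₁ e₂} → e₁ ∈ take k π → e₂ ∈ drop k π →
                  toℕ (block e₁) ≤ toℕ (block e₂)
    block-order k {e₁} {e₂} e₁∈ e₂∈ = ≮⇒≥ earlier-block
      where
      earlier-block : ¬ toℕ (block e₂) < toℕ (block e₁)
      earlier-block j₂<j₁ with ≤-total (nUpTo′ (toℕ (block e₁))) k
      ... | inj₁ n≤k = ∈-take⇒∉-drop k distinct
                         (∈-take-mono n≤k (∈-take-mono (nUpTo-mono j₂<j₁) (block-∈-take e₂))) e₂∈
      ... | inj₂ k≤n = ∈-take⇒∉-drop k distinct e₁∈ (∈-drop-mono k≤n (block-∈-drop e₁))

    cut⊆block : ∀ i {y ys} → drop i π ≡ y ∷ ys →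
                touched endsG (take i π) ∩ touched endsG (y ∷ ys) ⊆ˢ Vs (block y)
    cut⊆block i {y} {ys} eq v∈ with x∈p∩q⁻ _ _ v∈
    ... | v∈X , v∈Y with touched⁻ endsG (take i π) v∈X | touched⁻ endsG (y ∷ ys) v∈Y
    ...   | e₁ , e₁∈X , v∈e₁ | e₂ , e₂∈Y , v∈e₂ =
      bag-interval (block-order i e₁∈X (subst (y ∈_) (sym eq) (here refl))) (y-first e₂∈Y)
                   (incident⊆block e₁ v∈e₁) (incident⊆block e₂ v∈e₂)
      where
      y-first : ∀ {e} → e ∈ y ∷ ys → toℕ (block y) ≤ toℕ (block e)
      y-first (here refl)  = ≤-refl
      y-first (there e∈ys) with drop-∷ i eq
      ... | y∈take , eq′ = block-order (suc i) y∈take (subst (_ ∈_) (sym eq′) e∈ys)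

    ∣cut∣≤width+1 : ∀ i → ∣ touched endsG (take i π) ∩ touched endsG (drop i π) ∣ ≤
                         pathWidth t Vs + 1
    ∣cut∣≤width+1 i with drop i π in eq
    ... | []     =
      ≤-trans (≤-reflexive (trans (cong ∣_∣ (∩-zeroʳ (touched endsG (take i π)))) (∣⊥∣≡0 nv))) z≤n
    ... | y ∷ ys =
      ≤-trans (p⊆q⇒∣p∣≤∣q∣ {q = Vs (block y)} (cut⊆block i eq)) (∣bag∣≤width+1 (block y))

lemma3p5 : (nv m : ℕ) (endsG : Fin m → Fin nv × Fin nv) →
    Loopless endsG → ExactlyTwoParallel endsG →
    (t : ℕ) (Vs : Fin t → Subset nv) → IsPathDecomposition endsG t Vs →
    (π : List (EdgeBar nv m)) → IsOrdering π → Induces endsG Vs π →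
    ∀ (i a b c : ℕ) →
    IsRank (endsBar endsG) (λ e → e ∈ take i π) a →
    IsRank (endsBar endsG) (λ e → ¬ (e ∈ take i π)) b →
    IsRank (endsBar endsG) (λ _ → ⊤) c →
    a + b ∸ c ≤ pathWidth t Vs + 1
lemma3p5 nv m endsG _ _ t Vs pd π (distinct , complete) induces i a b c rank-a rank-b rank-c =
  begin
    a + b ∸ c                   ≤⟨ ∸-mono (+-mono-≤ a≤ b≤) (nv≤full-rank endsG rank-c) ⟩
    ∣ TX ∣ + ∣ TY ∣ ∸ nv         ≤⟨ ∣p∣+∣q∣∸n≤∣p∩q∣ TX TY ⟩
    ∣ TX ∩ TY ∣                  ≤⟨ ∣cut∣≤width+1 endsG Vs pd distinct induces i ⟩
    pathWidth t Vs + 1          ∎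
  where
  open ≤-Reasoning
  TX TY : Subset nv
  TX = touched endsG (take i π)
  TY = touched endsG (drop i π)
  a≤ : a ≤ ∣ TX ∣
  a≤ = rank≤∣touched∣ endsG (take i π) rank-a (λ e∈X → e∈X)
  b≤ : b ≤ ∣ TY ∣
  b≤ = rank≤∣touched∣ endsG (drop i π) rank-b (∉-take⇒∈-drop i (complete _))
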